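{- Let $\mathcal{H}=(V,E)$ be a connected hypergraph with a fixed total order on $E$, let $e_1,e_2$ be two distinct hyperedges of $\mathcal{H}$, and let $f_1,f_2$ be hypertrees of $\mathcal{H}$ with $f_1(e_1)<f_2(e_1)$ and $f_1(e)=f_2(e)$ for every $e\in E\setminus\{e_1,e_2\}$. Then for every hyperedge $e>\max\{e_1,e_2\}$, $e$ is internally active with respect to $f_1$ if and only if it is internally active with respect to $f_2$, and $e$ is externally active with respect to $f_1$ if and only if it is externally active with respect to $f_2$.
   Context: A hypergraph is a pair $\mathcal{H}=(V,E)$ with $V$ a finite set and $E$ a finite multiset of nonempty subsets of $V$ (hyperedges). Its associated bipartite graph $\mathrm{Bip}\,\mathcal{H}$ has colour classes $V$ and $E$, with $v\in V$ adjacent to $e\in E$ iff $v\in e$; $\mathcal{H}$ is connected if $\mathrm{Bip}\,\mathcal{H}$ is connected. A hypertree of $\mathcal{H}$ is a function $f:E\to\mathbb{N}=\{0,1,2,\dots\}$ such that there is a spanning tree $\tau$ of $\mathrm{Bip}\,\mathcal{H}$ with $d_\tau(e)=f(e)+1$ for all $e\in E$. For distinct hyperedges $a,b$, $a$ can transfer valence to $b$ with respect to a hypertree $f$ if the function obtained from $f$ by decreasing $f(a)$ by $1$ and increasing $f(b)$ by $1$ is also a hypertree. Given the order on $E$, a hyperedge $e$ is internally active with respect to $f$ if for every hyperedge $e'<e$, $e$ cannot transfer valence to $e'$ with respect to $f$; $e$ is externally active with respect to $f$ if for every hyperedge $e'<e$, $e'$ cannot transfer valence to $e$ with respect to $f$.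 -}

module Defs where

open import Data.Nat using (ℕ; suc; _≤_; _∸_)
open import Data.Fin using (Fin; _<_)
open import Data.Fin.Properties using (_≟_)
open import Data.Fin.Subset using (Subset; _∈_; _⊆_; ∣_∣; Nonempty)
open import Data.Sum using (_⊎_; inj₁; inj₂)
open import Data.Product using (Σ; _×_; ∃; ∃-syntax)
open import Data.Empty using (⊥)
open import Data.List using (List; _∷_; []; _++_; [_]; length)
open import Data.List.Relation.Unary.Linked using (Linked)
open import Data.List.Relation.Unary.Unique.Propositional using (Unique)
open import Relation.Binary.Construct.Closure.ReflexiveTransitive using (Star)
open import Relation.Binary.PropositionalEquality using (_≡_; _≢_)
open import Relation.Nullary using (¬_; yes; no)

-- A hypergraph with vertex set Fin n and hyperedges indexed by Fin m
-- (indexing realises the multiset of hyperedges); each hyperedge is a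
-- nonempty subset of the vertices.
record Hypergraph (n m : ℕ) : Set where
  field
    edge     : Fin m → Subset n
    nonempty : ∀ e → Nonempty (edge e)
open Hypergraph public

-- Nodes of the bipartite graph Bip H: vertices (inj₁) and hyperedges (inj₂).
Node : ℕ → ℕ → Set
Node n m = Fin n ⊎ Fin m

-- A subgraph of Bip H given by its edge set: T e is the set of vertices v
-- such that the edge {v , e} is selected.
Subgraph : ℕ → ℕ → Set
Subgraph n m = Fin m → Subset n

IsSubgraphOf : ∀ {n m} → Subgraph n m → Hypergraph n m → Set
IsSubgraphOf T H = ∀ e → T e ⊆ edge H e

Adj : ∀ {n m} → Subgraph n m → Node n m → Node n m → Set
Adj T (inj₁ v) (inj₁ w) = ⊥
Adj T (inj₁ v) (inj₂ e) = v ∈ T e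
Adj T (inj₂ e) (inj₁ v) = v ∈ T e
Adj T (inj₂ e) (inj₂ f) = ⊥

ConnectedSub : ∀ {n m} → Subgraph n m → Set
ConnectedSub {n} {m} T = ∀ (x y : Node n m) → Star (Adj T) x y

HasCycle : ∀ {n m} → Subgraph n m → Set
HasCycle {n} {m} T =
  Σ (Node n m) λ x → Σ (List (Node n m)) λ xs →
    Unique (x ∷ xs) × (2 ≤ length xs) × Linked (Adj T) (x ∷ xs ++ [ x ])

IsSpanningTree : ∀ {n m} → Hypergraph n m → Subgraph n m → Set
IsSpanningTree H T = IsSubgraphOf T H × ConnectedSub T × ¬ HasCycle T

Connected : ∀ {n m} → Hypergraph n m → Set
Connected H = ConnectedSub (edge H)

deg : ∀ {n m} → Subgraph n m → Fin m → ℕ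
deg T e = ∣ T e ∣

IsHypertree : ∀ {n m} → Hypergraph n m → (Fin m → ℕ) → Set
IsHypertree H f = ∃[ T ] (IsSpanningTree H T × (∀ e → deg T e ≡ suc (f e)))

transfer : ∀ {m} → (Fin m → ℕ) → Fin m → Fin m → (Fin m → ℕ)
transfer f a b x with x ≟ a
... | yes _ = f a ∸ 1
... | no _ with x ≟ b
...   | yes _ = suc (f b)
...   | no _ = f x

-- a can transfer valence to b w.r.t. f (f(a) ≥ 1 so that f(a) - 1 ∈ ℕ)
CanTransfer : ∀ {n m} → Hypergraph n m → (Fin m → ℕ) → Fin m → Fin m → Set
CanTransfer H f a b = a ≢ b × (1 ≤ f a) × IsHypertree H (transfer f a b)

-- the order on E is the order of Fin m
InternallyActive : ∀ {n m} → Hypergraph n m → (Fin m → ℕ) → Fin m → Set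
InternallyActive H f e = ∀ e' → e' < e → ¬ CanTransfer H f e e'

ExternallyActive : ∀ {n m} → Hypergraph n m → (Fin m → ℕ) → Fin m → Set
ExternallyActive H f e = ∀ e' → e' < e → ¬ CanTransfer H f e' e

-- Activity of e only involves transfers between e and smaller hyperedges, and hypertrees have the
-- exchange properties of integral polymatroid bases: if g i < f i, there is a j with f j < g j such
-- that i can transfer valence to j with respect to f, and one such that j can transfer valence to i
-- with respect to g.  Let f₁ and f₂ differ only below e, and let e transfer to e′ < e with respect
-- to f₂.  Exchanging f₁ against the transferred f₂ at e yields a transfer from e to some j with
-- respect to f₁ where j = e′ or f₁ j ≢ f₂ j, so that j < e as well; external activity is handled by
-- the second exchange property in the same way.
-- The exchange properties come from spanning trees T₁, T₂ of Bip H.  For a link a of T₁ missing from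
-- T₂, the first link c on the path in T₂ joining the ends of a that crosses the fundamental cut of a
-- in T₁ has a fundamental cut in T₂ separating the ends of a, so both T₁ - a + c and T₂ - c + a are
-- trees.  Repeating such swaps, each of which makes T₁ and T₂ share one more link, moves the surplus
-- degree at i to a hyperedge whose degree is too small.
module Submission where

open import Defs

module HypertreeExchange where

  open import Data.Bool using (Bool; true; false; not; _xor_)
  open import Data.Bool.Properties using (¬-not; not-¬; not-involutive; not-distribˡ-xor) renaming (_≟_ to _≟ᵇ_)
  open import Data.Fin using (Fin; zero; suc)
  open import Data.Fin.Properties using (_≟_)
  open import Data.Fin.Subset using (Subset; inside; outside; _∈_; _∉_; _⊆_; _-_; _∪_; _─_; ⁅_⁆; ∣_∣)
  open import Data.Fin.Subset.Properties
    using (p─⊥≡p; ∪-identityʳ; drop-there; x∈p∪q⁻; x∈p∪q⁺; x∈⁅x⁆; x∈⁅y⁆⇒x≡y;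
           x∈p∧x≢y⇒x∈p-y; x∈p∧x∉q⇒x∈p─q; p─q⊆p; p⊆q⇒∣p∣≤∣q∣; p⊂q⇒∣p∣<∣q∣)
  open import Data.List using (List; []; _∷_; _++_; [_])
  open import Data.List.Relation.Unary.All as All using (All; []; _∷_)
  open import Data.List.Relation.Unary.All.Properties using (¬Any⇒All¬; ++⁺)
  open import Data.List.Relation.Unary.AllPairs using ([]; _∷_)
  open import Data.List.Relation.Unary.Any using (Any; here; there; any?)
  open import Data.List.Relation.Unary.Linked as Linked using (Linked; []; [-]; _∷_)
  open import Data.List.Relation.Unary.Unique.Propositional using (Unique)
  open import Data.Nat using (ℕ; zero; suc; _+_; _∸_; _≤_; _<_; _<?_; s≤s; z≤n; s≤s⁻¹; s<s⁻¹)
  open import Data.Nat.Properties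
    using (+-0-monoid; +-commutativeSemigroup; +-comm; +-identityʳ; +-cancelʳ-≡; +-mono-≤; +-mono-<-≤;
           +-mono-≤-<; ≤-trans; <-≤-trans; n≤1+n; n<1+n; <-asym; <⇒≱; ≮⇒≥; m∸n+n≡m)
  open import Algebra.Properties.CommutativeSemigroup +-commutativeSemigroup using (xy∙z≈xz∙y)
  open import Algebra.Properties.Monoid.Sum +-0-monoid using (sum)
  open import Data.Product using (∃; ∃-syntax; _×_; _,_; proj₁; proj₂)
  open import Data.Product.Properties using () renaming (≡-dec to ×-≡-dec)
  open import Data.Sum as Sum using (_⊎_; inj₁; inj₂)
  open import Data.Sum.Properties using () renaming (≡-dec to ⊎-≡-dec)
  open import Data.Vec using (_∷_; here; there)
  open import Data.Vec.Functional using (updateAt)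
  open import Data.Vec.Functional.Properties using (updateAt-updates; updateAt-minimal)
  open import Function using (_∘_; id)
  open import Relation.Binary.Construct.Closure.ReflexiveTransitive as Star using (Star; ε; _◅_; _◅◅_)
  open import Relation.Binary.Definitions using (DecidableEquality)
  open import Relation.Binary.PropositionalEquality
    using (_≡_; _≢_; _≗_; refl; sym; trans; cong; cong₂; subst; subst₂; module ≡-Reasoning)
  open import Relation.Nullary using (Dec; yes; no; ¬_; contradiction)

  private variable
    k n m : ℕ
    S T G : Subgraph n m
    x y z z′ : Node n m
    xs : List (Node n m)

  -- Moving one unit between coordinates

  δ : Fin m → Fin m → ℕ
  δ i j with i ≟ j
  ... | yes _ = 1
  ... | no _  = 0

  δ-refl : (i : Fin m) → δ i i ≡ 1
  δ-refl i with i ≟ i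
  ... | yes _  = refl
  ... | no i≢i = contradiction refl i≢i

  δ-≢ : {i j : Fin m} → i ≢ j → δ i j ≡ 0
  δ-≢ {i = i} {j} i≢j with i ≟ j
  ... | yes i≡j = contradiction i≡j i≢j
  ... | no _    = refl

  -- y = x - δ i + δ j, with δ i moved to the left so that no subtraction occurs.
  record Moves (x : Fin m → ℕ) (i j : Fin m) (y : Fin m → ℕ) : Set where
    constructor moves
    field balance : ∀ e → y e + δ i e ≡ x e + δ j e

  module _ {x y : Fin m → ℕ} {i j : Fin m} (mv : Moves x i j y) where
    open Moves mv
    open ≡-Reasoning

    Moves-self : i ≡ j → y ≗ x
    Moves-self refl e = +-cancelʳ-≡ (δ i e) (y e) (x e) (balance e)

    Moves-source : i ≢ j → suc (y i) ≡ x i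
    Moves-source i≢j = begin
      suc (y i)    ≡⟨ +-comm 1 (y i) ⟩
      y i + 1      ≡⟨ cong (y i +_) (δ-refl i) ⟨
      y i + δ i i  ≡⟨ balance i ⟩
      x i + δ j i  ≡⟨ cong (x i +_) (δ-≢ (i≢j ∘ sym)) ⟩
      x i + 0      ≡⟨ +-identityʳ (x i) ⟩
      x i          ∎

    Moves-target : i ≢ j → y j ≡ suc (x j)
    Moves-target i≢j = begin
      y j          ≡⟨ +-identityʳ (y j) ⟨
      y j + 0      ≡⟨ cong (y j +_) (δ-≢ i≢j) ⟨
      y j + δ i j  ≡⟨ balance j ⟩
      x j + δ j j  ≡⟨ cong (x j +_) (δ-refl j) ⟩
      x j + 1      ≡⟨ +-comm (x j) 1 ⟩
      suc (x j)    ∎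

    Moves-other : ∀ {k} → k ≢ i → k ≢ j → y k ≡ x k
    Moves-other {k} k≢i k≢j = begin
      y k          ≡⟨ +-identityʳ (y k) ⟨
      y k + 0      ≡⟨ cong (y k +_) (δ-≢ (k≢i ∘ sym)) ⟨
      y k + δ i k  ≡⟨ balance k ⟩
      x k + δ j k  ≡⟨ cong (x k +_) (δ-≢ (k≢j ∘ sym)) ⟩
      x k + 0      ≡⟨ +-identityʳ (x k) ⟩
      x k          ∎

  Moves-trans : ∀ {x y z : Fin m → ℕ} {i j k} → Moves x i j y → Moves y j k z → Moves x i k z
  Moves-trans {x = x} {y} {z} {i} {j} {k} (moves xy) (moves yz) =
    moves λ e → +-cancelʳ-≡ (δ j e) (z e + δ i e) (x e + δ k e) (begin
      z e + δ i e + δ j e  ≡⟨ xy∙z≈xz∙y (z e) (δ i e) (δ j e) ⟩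
      z e + δ j e + δ i e  ≡⟨ cong (_+ δ i e) (yz e) ⟩
      y e + δ k e + δ i e  ≡⟨ xy∙z≈xz∙y (y e) (δ k e) (δ i e) ⟩
      y e + δ i e + δ k e  ≡⟨ cong (_+ δ k e) (xy e) ⟩
      x e + δ j e + δ k e  ≡⟨ xy∙z≈xz∙y (x e) (δ j e) (δ k e) ⟩
      x e + δ k e + δ j e  ∎)
    where open ≡-Reasoning

  Moves-trans′ : ∀ {x y z : Fin m → ℕ} {i j k} → Moves x i j y → Moves y k i z → Moves x k j z
  Moves-trans′ (moves xy) (moves yz) = moves λ e → trans (yz e) (xy e)

  exchange-step-down : ∀ {x y x′ : Fin m → ℕ} {i j} → Moves x i j x′ → y i < x i →
    x j < y j ⊎ (y j < x′ j × (∀ k → x′ k < y k → x k < y k))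
  exchange-step-down {x = x} {y} {x′} {i} {j} mv yi<xi with x j <? y j | i ≟ j
  ... | yes xj<yj | _        = inj₁ xj<yj
  ... | no _      | yes refl =
    inj₂ (subst (y i <_) (sym (Moves-self mv refl i)) yi<xi , λ k → subst (_< y k) (Moves-self mv refl k))
  ... | no xj≮yj  | no i≢j   = inj₂ (yj<x′j , back)
    where
    yj<x′j : y j < x′ j
    yj<x′j = subst (y j <_) (sym (Moves-target mv i≢j)) (s≤s (≮⇒≥ xj≮yj))
    back : ∀ k → x′ k < y k → x k < y k
    back k x′k<yk with k ≟ i | k ≟ j
    ... | _        | yes refl = contradiction x′k<yk (<-asym yj<x′j)
    ... | yes refl | no _     = contradiction (subst (_≤ y i) (Moves-source mv i≢j) x′k<yk) (<⇒≱ yi<xi)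
    ... | no k≢i   | no k≢j   = subst (_< y k) (Moves-other mv k≢i k≢j) x′k<yk

  exchange-step-up : ∀ {x y y′ : Fin m → ℕ} {i j} → Moves y j i y′ → y i < x i →
    x j < y j ⊎ (y′ j < x j × (∀ k → x k < y′ k → x k < y k))
  exchange-step-up {x = x} {y} {y′} {i} {j} mv yi<xi with x j <? y j | j ≟ i
  ... | yes xj<yj | _        = inj₁ xj<yj
  ... | no _      | yes refl =
    inj₂ (subst (_< x j) (sym (Moves-self mv refl j)) yi<xi , λ k → subst (x k <_) (Moves-self mv refl k))
  ... | no xj≮yj  | no j≢i   = inj₂ (y′j<xj , back)
    where
    y′j<xj : y′ j < x j
    y′j<xj = subst (_≤ x j) (sym (Moves-source mv j≢i)) (≮⇒≥ xj≮yj)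
    back : ∀ k → x k < y′ k → x k < y k
    back k xk<y′k with k ≟ j | k ≟ i
    ... | yes refl | _        = contradiction xk<y′k (<-asym y′j<xj)
    ... | no _     | yes refl = contradiction (s≤s⁻¹ (subst (x i <_) (Moves-target mv j≢i) xk<y′k)) (<⇒≱ yi<xi)
    ... | no k≢j   | no k≢i   = subst (x k <_) (Moves-other mv k≢j k≢i) xk<y′k

  -- Subsets and subgraphs of Bip H

  x∈p─q⇒x∉q : ∀ {x : Fin k} (p q : Subset k) → x ∈ p ─ q → x ∉ q
  x∈p─q⇒x∉q (inside ∷ p)  (outside ∷ q) here = λ ()
  x∈p─q⇒x∉q {x = zero} (outside ∷ p) (outside ∷ q) ()
  x∈p─q⇒x∉q (_ ∷ p) (_ ∷ q) (there x∈p─q) = x∈p─q⇒x∉q p q x∈p─q ∘ drop-there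

  ∣p∣≡1+∣p-x∣ : ∀ {x : Fin k} {p} → x ∈ p → ∣ p ∣ ≡ suc ∣ p - x ∣
  ∣p∣≡1+∣p-x∣ {p = inside ∷ p}  here        = cong (suc ∘ ∣_∣) (sym (p─⊥≡p p))
  ∣p∣≡1+∣p-x∣ {p = inside ∷ p}  (there x∈p) = cong suc (∣p∣≡1+∣p-x∣ x∈p)
  ∣p∣≡1+∣p-x∣ {p = outside ∷ p} (there x∈p) = ∣p∣≡1+∣p-x∣ x∈p

  ∣p∪⁅x⁆∣≡1+∣p∣ : ∀ {x : Fin k} {p} → x ∉ p → ∣ p ∪ ⁅ x ⁆ ∣ ≡ suc ∣ p ∣
  ∣p∪⁅x⁆∣≡1+∣p∣ {x = zero}  {p = inside ∷ p}  x∉p = contradiction here x∉p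
  ∣p∪⁅x⁆∣≡1+∣p∣ {x = zero}  {p = outside ∷ p} x∉p = cong (suc ∘ ∣_∣) (∪-identityʳ p)
  ∣p∪⁅x⁆∣≡1+∣p∣ {x = suc x} {p = inside ∷ p}  x∉p = cong suc (∣p∪⁅x⁆∣≡1+∣p∣ (x∉p ∘ there))
  ∣p∪⁅x⁆∣≡1+∣p∣ {x = suc x} {p = outside ∷ p} x∉p = ∣p∪⁅x⁆∣≡1+∣p∣ (x∉p ∘ there)

  there∈∉ : ∀ {s t} {p q : Subset k} → ∃[ x ] x ∈ q × x ∉ p → ∃[ x ] x ∈ t ∷ q × x ∉ s ∷ p
  there∈∉ (x , x∈q , x∉p) = suc x , there x∈q , x∉p ∘ drop-there

  ∣p∣<∣q∣⇒∃∈q∉p : ∀ (p q : Subset k) → ∣ p ∣ < ∣ q ∣ → ∃[ x ] x ∈ q × x ∉ p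
  ∣p∣<∣q∣⇒∃∈q∉p (outside ∷ p) (inside ∷ q)  _        = zero , here , λ ()
  ∣p∣<∣q∣⇒∃∈q∉p (inside ∷ p)  (inside ∷ q)  (s≤s lt) = there∈∉ (∣p∣<∣q∣⇒∃∈q∉p p q lt)
  ∣p∣<∣q∣⇒∃∈q∉p (outside ∷ p) (outside ∷ q) lt       = there∈∉ (∣p∣<∣q∣⇒∃∈q∉p p q lt)
  ∣p∣<∣q∣⇒∃∈q∉p (inside ∷ p)  (outside ∷ q) lt       =
    there∈∉ (∣p∣<∣q∣⇒∃∈q∉p p q (≤-trans (n≤1+n _) lt))

  sum-mono-≤ : ∀ {f g : Fin k → ℕ} → (∀ i → f i ≤ g i) → sum f ≤ sum g
  sum-mono-≤ {zero}  f≤g = z≤n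
  sum-mono-≤ {suc k} f≤g = +-mono-≤ (f≤g zero) (sum-mono-≤ (f≤g ∘ suc))

  sum-mono-< : ∀ {f g : Fin k → ℕ} → (∀ i → f i ≤ g i) → ∀ i → f i < g i → sum f < sum g
  sum-mono-< {suc k} f≤g zero    fi<gi = +-mono-<-≤ fi<gi (sum-mono-≤ (f≤g ∘ suc))
  sum-mono-< {suc k} f≤g (suc i) fi<gi = +-mono-≤-< (f≤g zero) (sum-mono-< (f≤g ∘ suc) i fi<gi)

  Link : ℕ → ℕ → Set
  Link n m = Fin n × Fin m

  private variable
    c d l : Link n m

  _≟ₗ_ : DecidableEquality (Link n m)
  _≟ₗ_ = ×-≡-dec _≟_ _≟_

  infix 4 _∈ₗ_ _∉ₗ_ _⊆ₗ_

  data _∈ₗ_ : Link n m → Subgraph n m → Set where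
    link : ∀ {T : Subgraph n m} {v e} → v ∈ T e → (v , e) ∈ₗ T

  unlink : ∀ {T : Subgraph n m} {v e} → (v , e) ∈ₗ T → v ∈ T e
  unlink (link v∈Te) = v∈Te

  _∉ₗ_ : Link n m → Subgraph n m → Set
  l ∉ₗ T = ¬ l ∈ₗ T

  _⊆ₗ_ : Subgraph n m → Subgraph n m → Set
  S ⊆ₗ T = ∀ {l} → l ∈ₗ S → l ∈ₗ T

  infixl 6 _⊖_ _⊕_ _∖_

  _⊖_ : Subgraph n m → Link n m → Subgraph n m
  T ⊖ (v , e) = updateAt T e (_- v)

  _⊕_ : Subgraph n m → Link n m → Subgraph n m
  T ⊕ (v , e) = updateAt T e (_∪ ⁅ v ⁆)

  _∖_ : Subgraph n m → Subgraph n m → Subgraph n m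
  (S ∖ T) e = S e ─ T e

  size : Subgraph n m → ℕ
  size T = sum (λ e → ∣ T e ∣)

  module _ (T : Subgraph n m) {f : Subset n → Subset n} {v : Fin n} where

    ∈-updateAt-here⁻ : ∀ {e} → v ∈ updateAt T e f e → v ∈ f (T e)
    ∈-updateAt-here⁻ {e} = subst (v ∈_) (updateAt-updates e T)

    ∈-updateAt-here⁺ : ∀ {e} → v ∈ f (T e) → v ∈ updateAt T e f e
    ∈-updateAt-here⁺ {e} = subst (v ∈_) (sym (updateAt-updates e T))

    ∈-updateAt-other⁻ : ∀ {e e′} → e ≢ e′ → v ∈ updateAt T e′ f e → v ∈ T e
    ∈-updateAt-other⁻ {e} {e′} e≢e′ = subst (v ∈_) (updateAt-minimal e e′ T e≢e′)

    ∈-updateAt-other⁺ : ∀ {e e′} → e ≢ e′ → v ∈ T e → v ∈ updateAt T e′ f e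
    ∈-updateAt-other⁺ {e} {e′} e≢e′ = subst (v ∈_) (sym (updateAt-minimal e e′ T e≢e′))

  ∈-⊖⁺ : l ∈ₗ T → l ≢ c → l ∈ₗ T ⊖ c
  ∈-⊖⁺ {T = T} {c = w , e′} (link {e = e} v∈Te) l≢c with e ≟ e′
  ... | yes refl = link (∈-updateAt-here⁺ T (x∈p∧x≢y⇒x∈p-y v∈Te (λ { refl → l≢c refl })))
  ... | no e≢e′  = link (∈-updateAt-other⁺ T e≢e′ v∈Te)

  ∈-⊖⁻ : l ∈ₗ T ⊖ c → l ∈ₗ T × l ≢ c
  ∈-⊖⁻ {T = T} {c = w , e′} (link {v = v} {e} v∈) with e ≟ e′
  ... | yes refl = link (p─q⊆p _ _ v∈Te-w) , λ { refl → x∈p─q⇒x∉q (T e) _ v∈Te-w (x∈⁅x⁆ v) }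
    where v∈Te-w = ∈-updateAt-here⁻ T v∈
  ... | no e≢e′  = link (∈-updateAt-other⁻ T e≢e′ v∈) , λ { refl → e≢e′ refl }

  ∈-⊕⁺ : l ∈ₗ T ⊎ l ≡ d → l ∈ₗ T ⊕ d
  ∈-⊕⁺ {T = T} {d = w , e′} (inj₁ (link {e = e} v∈Te)) with e ≟ e′
  ... | yes refl = link (∈-updateAt-here⁺ T (x∈p∪q⁺ (inj₁ v∈Te)))
  ... | no e≢e′  = link (∈-updateAt-other⁺ T e≢e′ v∈Te)
  ∈-⊕⁺ {T = T} {d = w , e′} (inj₂ refl) = link (∈-updateAt-here⁺ T (x∈p∪q⁺ (inj₂ (x∈⁅x⁆ w))))

  ∈-⊕⁻ : l ∈ₗ T ⊕ d → l ∈ₗ T ⊎ l ≡ d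
  ∈-⊕⁻ {T = T} {d = w , e′} (link {v = v} {e} v∈) with e ≟ e′
  ... | no e≢e′  = inj₁ (link (∈-updateAt-other⁻ T e≢e′ v∈))
  ... | yes refl with x∈p∪q⁻ (T e) _ (∈-updateAt-here⁻ T v∈)
  ...   | inj₁ v∈Te  = inj₁ (link v∈Te)
  ...   | inj₂ v∈⁅w⁆ = inj₂ (cong (_, e) (x∈⁅y⁆⇒x≡y w v∈⁅w⁆))

  ∈-⊕-old : l ∈ₗ T ⊕ d → l ≢ d → l ∈ₗ T
  ∈-⊕-old l∈T⊕d l≢d = Sum.[ id , (λ l≡d → contradiction l≡d l≢d) ]′ (∈-⊕⁻ l∈T⊕d)

  ∈-∖⁺ : l ∈ₗ S → l ∉ₗ T → l ∈ₗ S ∖ T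
  ∈-∖⁺ (link v∈Se) l∉T = link (x∈p∧x∉q⇒x∈p─q v∈Se (l∉T ∘ link))

  ∈-∖⁻ : l ∈ₗ S ∖ T → l ∈ₗ S × l ∉ₗ T
  ∈-∖⁻ {S = S} {T = T} (link {e = e} v∈) =
    link (p─q⊆p (S e) (T e) v∈) , λ { (link v∈Te) → x∈p─q⇒x∉q (S e) (T e) v∈ v∈Te }

  deg-⊖ : c ∈ₗ T → ∀ e → deg (T ⊖ c) e + δ (proj₂ c) e ≡ deg T e
  deg-⊖ {T = T} (link {v = w} {e′} w∈Te′) e with e ≟ e′
  ... | yes refl = begin
    ∣ updateAt T e (_- w) e ∣ + δ e e  ≡⟨ cong₂ _+_ (cong ∣_∣ (updateAt-updates e T)) (δ-refl e) ⟩
    ∣ T e - w ∣ + 1                   ≡⟨ +-comm _ 1 ⟩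
    suc ∣ T e - w ∣                   ≡⟨ ∣p∣≡1+∣p-x∣ w∈Te′ ⟨
    ∣ T e ∣                           ∎
    where open ≡-Reasoning
  ... | no e≢e′ = begin
    ∣ updateAt T e′ (_- w) e ∣ + δ e′ e  ≡⟨ cong₂ _+_ (cong ∣_∣ (updateAt-minimal e e′ T e≢e′))
                                                    (δ-≢ (e≢e′ ∘ sym)) ⟩
    ∣ T e ∣ + 0                         ≡⟨ +-identityʳ _ ⟩
    ∣ T e ∣                             ∎
    where open ≡-Reasoning

  deg-⊕ : d ∉ₗ T → ∀ e → deg (T ⊕ d) e ≡ deg T e + δ (proj₂ d) e
  deg-⊕ {d = w , e′} {T = T} d∉T e with e ≟ e′
  ... | yes refl = begin
    ∣ updateAt T e (_∪ ⁅ w ⁆) e ∣  ≡⟨ cong ∣_∣ (updateAt-updates e T) ⟩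
    ∣ T e ∪ ⁅ w ⁆ ∣               ≡⟨ ∣p∪⁅x⁆∣≡1+∣p∣ (d∉T ∘ link) ⟩
    suc ∣ T e ∣                   ≡⟨ +-comm 1 _ ⟩
    ∣ T e ∣ + 1                   ≡⟨ cong (∣ T e ∣ +_) (δ-refl e) ⟨
    ∣ T e ∣ + δ e e               ∎
    where open ≡-Reasoning
  ... | no e≢e′ = begin
    ∣ updateAt T e′ (_∪ ⁅ w ⁆) e ∣  ≡⟨ cong ∣_∣ (updateAt-minimal e e′ T e≢e′) ⟩
    ∣ T e ∣                         ≡⟨ +-identityʳ _ ⟨
    ∣ T e ∣ + 0                     ≡⟨ cong (∣ T e ∣ +_) (δ-≢ (e≢e′ ∘ sym)) ⟨
    ∣ T e ∣ + δ e′ e                ∎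
    where open ≡-Reasoning

  deg-swap : c ∈ₗ T → d ∉ₗ T → Moves (deg T) (proj₂ c) (proj₂ d) (deg (T ⊖ c ⊕ d))
  deg-swap {c = c} {T = T} {d = d} c∈T d∉T = moves λ e → begin
    deg (T ⊖ c ⊕ d) e + δ (proj₂ c) e              ≡⟨ cong (_+ δ (proj₂ c) e) (deg-⊕ d∉T⊖c e) ⟩
    deg (T ⊖ c) e + δ (proj₂ d) e + δ (proj₂ c) e  ≡⟨ xy∙z≈xz∙y (deg (T ⊖ c) e) (δ (proj₂ d) e) _ ⟩
    deg (T ⊖ c) e + δ (proj₂ c) e + δ (proj₂ d) e  ≡⟨ cong (_+ δ (proj₂ d) e) (deg-⊖ c∈T e) ⟩
    deg T e + δ (proj₂ d) e                        ∎
    where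
    open ≡-Reasoning
    d∉T⊖c : d ∉ₗ T ⊖ c
    d∉T⊖c = d∉T ∘ proj₁ ∘ ∈-⊖⁻ {T = T} {c = c}

  size-⊂ : S ⊆ₗ T → l ∈ₗ T → l ∉ₗ S → size S < size T
  size-⊂ {S = S} {T = T} S⊆T (link {v = v} {e} v∈Te) l∉S =
    sum-mono-< (λ _ → p⊆q⇒∣p∣≤∣q∣ Se⊆Te) e (p⊂q⇒∣p∣<∣q∣ (Se⊆Te , v , v∈Te , l∉S ∘ link))
    where
    Se⊆Te : ∀ {e} → S e ⊆ T e
    Se⊆Te = unlink ∘ S⊆T ∘ link

  size-∖-swapˡ : c ∈ₗ S → c ∉ₗ T → d ∈ₗ T → size (S ⊖ c ⊕ d ∖ T) < size (S ∖ T)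
  size-∖-swapˡ {c = c} {S = S} {T = T} {d = d} c∈S c∉T d∈T = size-⊂ shrinks (∈-∖⁺ c∈S c∉T) c∉
    where
    shrinks : S ⊖ c ⊕ d ∖ T ⊆ₗ S ∖ T
    shrinks l∈ with ∈-∖⁻ l∈
    ... | l∈S′ , l∉T with ∈-⊕⁻ l∈S′
    ...   | inj₁ l∈S⊖c = ∈-∖⁺ (proj₁ (∈-⊖⁻ {T = S} l∈S⊖c)) l∉T
    ...   | inj₂ refl  = contradiction d∈T l∉T
    c∉ : c ∉ₗ S ⊖ c ⊕ d ∖ T
    c∉ c∈ with ∈-⊕⁻ (proj₁ (∈-∖⁻ c∈))
    ... | inj₁ c∈S⊖c = proj₂ (∈-⊖⁻ {T = S} c∈S⊖c) refl
    ... | inj₂ refl  = c∉T d∈T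

  size-∖-swapʳ : c ∈ₗ S → c ∉ₗ T → d ∉ₗ S → size (S ∖ (T ⊖ d ⊕ c)) < size (S ∖ T)
  size-∖-swapʳ {c = c} {S = S} {T = T} {d = d} c∈S c∉T d∉S = size-⊂ shrinks (∈-∖⁺ c∈S c∉T) c∉
    where
    shrinks : S ∖ (T ⊖ d ⊕ c) ⊆ₗ S ∖ T
    shrinks {l} l∈ with ∈-∖⁻ l∈
    ... | l∈S , l∉T′ = ∈-∖⁺ l∈S l∉T
      where
      l∉T : l ∉ₗ T
      l∉T l∈T with l ≟ₗ d
      ... | yes refl = d∉S l∈S
      ... | no l≢d   = l∉T′ (∈-⊕⁺ (inj₁ (∈-⊖⁺ l∈T l≢d)))
    c∉ : c ∉ₗ S ∖ (T ⊖ d ⊕ c)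
    c∉ c∈ = proj₂ (∈-∖⁻ c∈) (∈-⊕⁺ (inj₂ refl))

  -- Walks, paths and fundamental cuts

  _≟ₙ_ : DecidableEquality (Node n m)
  _≟ₙ_ = ⊎-≡-dec _≟_ _≟_

  vertexNode edgeNode : Link n m → Node n m
  vertexNode (v , e) = inj₁ v
  edgeNode   (v , e) = inj₂ e

  data Joins {n m} : Link n m → Node n m → Node n m → Set where
    forward  : ∀ {v e} → Joins (v , e) (inj₁ v) (inj₂ e)
    backward : ∀ {v e} → Joins (v , e) (inj₂ e) (inj₁ v)

  joins-ends : ∀ (l : Link n m) → Joins l (vertexNode l) (edgeNode l)
  joins-ends (v , e) = forward

  joins-flip : Joins l x y → Joins l y x
  joins-flip forward  = backward
  joins-flip backward = forward

  joins-end : Joins l x y → Joins l z z′ → z ≡ x ⊎ z ≡ y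
  joins-end forward  forward  = inj₁ refl
  joins-end forward  backward = inj₂ refl
  joins-end backward forward  = inj₂ refl
  joins-end backward backward = inj₁ refl

  adj⇒link : Adj G x y → ∃[ l ] l ∈ₗ G × Joins l x y
  adj⇒link {x = inj₁ v} {inj₂ e} v∈Ge = (v , e) , link v∈Ge , forward
  adj⇒link {x = inj₂ e} {inj₁ v} v∈Ge = (v , e) , link v∈Ge , backward

  link⇒adj : l ∈ₗ G → Joins l x y → Adj G x y
  link⇒adj (link v∈Ge) forward  = v∈Ge
  link⇒adj (link v∈Ge) backward = v∈Ge

  adj-sym : Adj G x y → Adj G y x
  adj-sym {x = inj₁ _} {inj₂ _} a = a
  adj-sym {x = inj₂ _} {inj₁ _} a = a

  adj-mono : S ⊆ₗ T → Adj S x y → Adj T x y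
  adj-mono S⊆T a with adj⇒link a
  ... | _ , l∈S , joins = link⇒adj (S⊆T l∈S) joins

  Walk : Subgraph n m → Node n m → Node n m → Set
  Walk G = Star (Adj G)

  reverse : Walk G x y → Walk G y x
  reverse = Star.reverse adj-sym

  ReachesEnd : Subgraph n m → Link n m → Node n m → Set
  ReachesEnd G c x = Walk G x (vertexNode c) ⊎ Walk G x (edgeNode c)

  joins⇒reachesEnd : Joins c x y → ReachesEnd G c x
  joins⇒reachesEnd forward  = inj₁ ε
  joins⇒reachesEnd backward = inj₂ ε

  walk-⊖ : Walk T x y → Walk (T ⊖ c) x y ⊎ ReachesEnd (T ⊖ c) c x
  walk-⊖ ε = inj₁ ε
  walk-⊖ {c = c} (a ◅ w) with adj⇒link a
  ... | l , l∈T , joins with l ≟ₗ c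
  ...   | yes refl = inj₂ (joins⇒reachesEnd joins)
  ...   | no l≢c   = Sum.map (a′ ◅_) (Sum.map (a′ ◅_) (a′ ◅_)) (walk-⊖ w)
    where a′ = link⇒adj (∈-⊖⁺ l∈T l≢c) joins

  reachesEnd-⊖ : ConnectedSub T → ∀ c x → ReachesEnd (T ⊖ c) c x
  reachesEnd-⊖ connected c x = Sum.[ inj₁ , id ] (walk-⊖ (connected x (vertexNode c)))

  lastOf : Node n m → List (Node n m) → Node n m
  lastOf x []       = x
  lastOf x (y ∷ ys) = lastOf y ys

  lastOf-snoc : ∀ (xs : List (Node n m)) → lastOf y (xs ++ [ x ]) ≡ x
  lastOf-snoc []       = refl
  lastOf-snoc (_ ∷ xs) = lastOf-snoc xs

  linked-snoc : ∀ {R : Node n m → Node n m → Set} xs →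
    Linked R (x ∷ xs) → R (lastOf x xs) y → Linked R (x ∷ xs ++ [ y ])
  linked-snoc []       [-]           r = r ∷ [-]
  linked-snoc (_ ∷ xs) (r′ ∷ linked) r = r′ ∷ linked-snoc xs linked r

  record Path (G : Subgraph n m) (x y : Node n m) : Set where
    constructor path
    field
      nodes  : List (Node n m)
      linked : Linked (Adj G) (x ∷ nodes)
      unique : Unique (x ∷ nodes)
      ends   : lastOf x nodes ≡ y

  suffix : (p : Path G x y) → Any (z ≡_) (x ∷ Path.nodes p) → Path G z y
  suffix p (here refl) = p
  suffix (path (_ ∷ zs) (_ ∷ linked) (_ ∷ unique) ends) (there z∈) = suffix (path zs linked unique ends) z∈

  walk⇒path : Walk G x y → Path G x y
  walk⇒path ε = path [] [-] ([] ∷ []) refl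
  walk⇒path {x = x} (_◅_ {j = x′} a w) with walk⇒path w
  ... | p@(path zs linked unique ends) with any? (x ≟ₙ_) (x′ ∷ zs)
  ...   | yes x∈ = suffix p x∈
  ...   | no x∉  = path (x′ ∷ zs) (a ∷ linked) (¬Any⇒All¬ _ x∉ ∷ unique) ends

  acyclic⇒no-bypass : ¬ HasCycle T → c ∈ₗ T → ¬ Walk (T ⊖ c) (vertexNode c) (edgeNode c)
  acyclic⇒no-bypass {T = T} {c = v , e} acyclic c∈T w with walk⇒path w
  ... | path (_ ∷ []) (a ∷ [-]) _ refl = proj₂ (∈-⊖⁻ {T = T} (link a)) refl
  ... | path zs@(_ ∷ _ ∷ _) linked unique ends =
    acyclic (inj₁ v , zs , unique , s≤s (s≤s z≤n) , linked-snoc zs linked-in-T closing)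
    where
    linked-in-T : Linked (Adj T) (inj₁ v ∷ zs)
    linked-in-T = Linked.map (adj-mono (proj₁ ∘ ∈-⊖⁻)) linked
    closing : Adj T (lastOf (inj₁ v) zs) (inj₁ v)
    closing = subst (λ z → Adj T z (inj₁ v)) (sym ends) (unlink c∈T)

  Colouring : ℕ → ℕ → Set
  Colouring n m = Node n m → Bool

  private variable
    ℓ : Colouring n m

  Agrees : Colouring n m → Link n m → Set
  Agrees ℓ l = ℓ (vertexNode l) ≡ ℓ (edgeNode l)

  Separates : Colouring n m → Link n m → Set
  Separates ℓ l = ¬ Agrees ℓ l

  joins-agrees : Joins l x y → Agrees ℓ l → ℓ x ≡ ℓ y
  joins-agrees forward  = id
  joins-agrees backward = sym

  joins-agrees⁻ : Joins l x y → ℓ x ≡ ℓ y → Agrees ℓ l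
  joins-agrees⁻ forward  = id
  joins-agrees⁻ backward = sym

  walk-constant : (∀ {l} → l ∈ₗ G → Agrees ℓ l) → Walk G x y → ℓ x ≡ ℓ y
  walk-constant agrees ε       = refl
  walk-constant agrees (a ◅ w) with adj⇒link a
  ... | _ , l∈G , joins = trans (joins-agrees joins (agrees l∈G)) (walk-constant agrees w)

  record FundamentalCut (T : Subgraph n m) (c : Link n m) (ℓ : Colouring n m) : Set where
    field
      separates : Separates ℓ c
      agrees    : ∀ {l} → l ∈ₗ T → l ≢ c → Agrees ℓ l

    agrees-⊖ : ∀ {l} → l ∈ₗ T ⊖ c → Agrees ℓ l
    agrees-⊖ l∈T⊖c = let l∈T , l≢c = ∈-⊖⁻ l∈T⊖c in agrees l∈T l≢c

    separated-unique : ∀ {l} → l ∈ₗ T → Separates ℓ l → l ≡ c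
    separated-unique {l} l∈T sep with l ≟ₗ c
    ... | yes l≡c = l≡c
    ... | no l≢c  = contradiction (agrees l∈T l≢c) sep

  AllBridges : Subgraph n m → Set
  AllBridges T = ∀ {c} → c ∈ₗ T → ∃ (FundamentalCut T c)

  -- For connected subgraphs this is equivalent to acyclicity (acyclic⇒fundamentalCut, allBridges⇒acyclic),
  -- and it is the form of acyclicity that link swaps preserve (swap-tree).
  record Tree (T : Subgraph n m) : Set where
    field
      connected : ConnectedSub T
      bridges   : AllBridges T

  acyclic⇒fundamentalCut : ConnectedSub T → ¬ HasCycle T → c ∈ₗ T → ∃ (FundamentalCut T c)
  acyclic⇒fundamentalCut {T = T} {c = c} connected acyclic c∈T =
    colour , record { separates = separates ; agrees = agrees }
    where
    reach : ∀ x → ReachesEnd (T ⊖ c) c x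
    reach = reachesEnd-⊖ connected c
    side : ∀ {x} → ReachesEnd (T ⊖ c) c x → Bool
    side (inj₁ _) = true
    side (inj₂ _) = false
    colour : Colouring _ _
    colour x = side (reach x)
    no-bypass = acyclic⇒no-bypass acyclic c∈T
    separates : Separates colour c
    separates with reach (vertexNode c) | reach (edgeNode c)
    ... | inj₁ _ | inj₂ _ = λ ()
    ... | inj₂ w | _      = contradiction w no-bypass
    ... | inj₁ _ | inj₁ w = contradiction (reverse w) no-bypass
    agrees : ∀ {l} → l ∈ₗ T → l ≢ c → Agrees colour l
    agrees {l = v , e} l∈T l≢c with reach (inj₁ v) | reach (inj₂ e)
    ... | inj₁ _  | inj₁ _  = refl
    ... | inj₂ _  | inj₂ _  = refl
    ... | inj₁ w₁ | inj₂ w₂ = contradiction (reverse w₁ ◅◅ unlink (∈-⊖⁺ l∈T l≢c) ◅ w₂) no-bypass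
    ... | inj₂ w₁ | inj₁ w₂ = contradiction (reverse w₂ ◅◅ unlink (∈-⊖⁺ l∈T l≢c) ◅ w₁) no-bypass

  linked-avoiding-constant : FundamentalCut G c ℓ → Joins c z z′ →
    Linked (Adj G) (x ∷ xs) → All (z ≢_) (x ∷ xs) → ℓ x ≡ ℓ (lastOf x xs)
  linked-avoiding-constant cut jc [-]          _            = refl
  linked-avoiding-constant cut jc (a ∷ linked) (z≢x ∷ z∉xs) with adj⇒link a
  ... | l , l∈G , joins =
    trans (joins-agrees joins (FundamentalCut.agrees cut l∈G l≢c)) (linked-avoiding-constant cut jc linked z∉xs)
    where
    l≢c : l ≢ _
    l≢c refl = Sum.[ z≢x , All.head z∉xs ]′ (joins-end joins jc)

  allBridges⇒acyclic : AllBridges T → ¬ HasCycle T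
  allBridges⇒acyclic bridges (_ , _ ∷ [] , _ , s≤s () , _)
  allBridges⇒acyclic bridges (x , x₁ ∷ x₂ ∷ xs , (x∉ ∷ x₁∉ ∷ _) , _ , a ∷ a₁ ∷ linked)
    with adj⇒link a | adj⇒link a₁
  ... | c , c∈T , joins | l₁ , l₁∈T , joins₁ with bridges c∈T
  ...   | ℓ , cut = FundamentalCut.separates cut (joins-agrees⁻ joins (sym (trans ℓx₁≡ℓx₂ ℓx₂≡ℓx)))
    where
    l₁≢c : l₁ ≢ c
    l₁≢c refl = Sum.[ All.head x∉ , All.head (All.tail x∉) ]′ (joins-end joins₁ joins)
    ℓx₁≡ℓx₂ : ℓ x₁ ≡ ℓ x₂
    ℓx₁≡ℓx₂ = joins-agrees joins₁ (FundamentalCut.agrees cut l₁∈T l₁≢c)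
    ℓx₂≡ℓx : ℓ x₂ ≡ ℓ x
    ℓx₂≡ℓx = trans (linked-avoiding-constant cut (joins-flip joins) linked x₁∉rest) (cong ℓ (lastOf-snoc xs))
      where x₁∉rest = ++⁺ x₁∉ ((All.head x∉ ∘ sym) ∷ [])

  -- The witness is the first link of the path separated by ℓ: its own cut separates the ends of the
  -- path, because the rest of the path avoids x.
  path-crossing : AllBridges G → Linked (Adj G) (x ∷ xs) → Unique (x ∷ xs) → ℓ x ≢ ℓ (lastOf x xs) →
    ∃[ c ] c ∈ₗ G × Separates ℓ c × ∃[ ℓc ] FundamentalCut G c ℓc × ℓc x ≢ ℓc (lastOf x xs)
  path-crossing bridges [-] _ ℓx≢ℓx = contradiction refl ℓx≢ℓx
  path-crossing {ℓ = ℓ} bridges (_∷_ {x = x} {y = x′} a linked) (x∉ ∷ unique) ℓx≢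
    with adj⇒link a | ℓ x ≟ᵇ ℓ x′
  ... | c₀ , c₀∈G , joins | no ℓx≢ℓx′ =
    c₀ , c₀∈G , ℓx≢ℓx′ ∘ joins-agrees joins , ℓ₀ , cut₀ ,
    λ eq → FundamentalCut.separates cut₀
             (joins-agrees⁻ joins (trans eq (sym (linked-avoiding-constant cut₀ joins linked x∉))))
    where
    ℓ₀ = proj₁ (bridges c₀∈G)
    cut₀ = proj₂ (bridges c₀∈G)
  ... | c₀ , c₀∈G , joins | yes ℓx≡ℓx′
    with path-crossing {ℓ = ℓ} bridges linked unique (ℓx≢ ∘ trans ℓx≡ℓx′)
  ...   | c , c∈G , sep , ℓc , cut , ℓcx′≢ =
    c , c∈G , sep , ℓc , cut , ℓcx′≢ ∘ trans (sym (joins-agrees joins (FundamentalCut.agrees cut c₀∈G c₀≢c)))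
    where
    c₀≢c : c₀ ≢ c
    c₀≢c refl = sep (joins-agrees⁻ joins ℓx≡ℓx′)

  -- Swapping links in trees

  xor-agrees : ∀ {a b c d} → a ≢ b → c ≢ d → a xor c ≡ b xor d
  xor-agrees {b = b} {d = d} a≢b c≢d rewrite ¬-not a≢b | ¬-not c≢d = not-xor-not b d
    where
    not-xor-not : ∀ b d → not b xor not d ≡ b xor d
    not-xor-not true  d = refl
    not-xor-not false d = not-involutive d

  xor-separates : ∀ {a b c d} → a ≢ b → c ≡ d → a xor c ≢ b xor d
  xor-separates {b = b} {c = c} a≢b refl rewrite ¬-not a≢b | sym (not-distribˡ-xor b c) = not-¬ refl ∘ sym

  module _ {T : Subgraph n m} {c d : Link n m} {ℓ : Colouring n m}
           (cut : FundamentalCut T c ℓ) (d-crosses : Separates ℓ d) where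
    open FundamentalCut cut using (agrees-⊖)

    swap-connected : ConnectedSub T → ConnectedSub (T ⊖ c ⊕ d)
    swap-connected connected a b = to-vertexNode a ◅◅ reverse (to-vertexNode b)
      where
      reach : ∀ x → ReachesEnd (T ⊖ c) c x
      reach = reachesEnd-⊖ connected c
      lift : Walk (T ⊖ c) x y → Walk (T ⊖ c ⊕ d) x y
      lift = Star.map (adj-mono (∈-⊕⁺ ∘ inj₁))
      d-link : Joins d x y → Adj (T ⊖ c ⊕ d) x y
      d-link = link⇒adj (∈-⊕⁺ (inj₂ refl))
      same-colour : Walk (T ⊖ c) x z → Walk (T ⊖ c) y z → ℓ x ≡ ℓ y
      same-colour w₁ w₂ = trans (walk-constant {ℓ = ℓ} agrees-⊖ w₁) (sym (walk-constant {ℓ = ℓ} agrees-⊖ w₂))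
      bypass : Walk (T ⊖ c ⊕ d) (edgeNode c) (vertexNode c)
      bypass with reach (vertexNode d) | reach (edgeNode d)
      ... | inj₁ w₁ | inj₂ w₂ = reverse (lift w₂) ◅◅ d-link (joins-flip (joins-ends d)) ◅ lift w₁
      ... | inj₂ w₁ | inj₁ w₂ = reverse (lift w₁) ◅◅ d-link (joins-ends d) ◅ lift w₂
      ... | inj₁ w₁ | inj₁ w₂ = contradiction (same-colour w₁ w₂) d-crosses
      ... | inj₂ w₁ | inj₂ w₂ = contradiction (same-colour w₁ w₂) d-crosses
      to-vertexNode : ∀ x → Walk (T ⊖ c ⊕ d) x (vertexNode c)
      to-vertexNode x = Sum.[ lift , (λ w → lift w ◅◅ bypass) ]′ (reach x)

    swap-bridges : AllBridges T → AllBridges (T ⊖ c ⊕ d)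
    swap-bridges bridges l∈T′ with ∈-⊕⁻ l∈T′
    ... | inj₂ refl =
      ℓ , record { separates = d-crosses ; agrees = λ l′∈T′ l′≢d → agrees-⊖ (∈-⊕-old l′∈T′ l′≢d) }
    ... | inj₁ l∈T⊖c with bridges (proj₁ (∈-⊖⁻ l∈T⊖c))
    ...   | ℓₗ , cutₗ with ℓₗ (vertexNode d) ≟ᵇ ℓₗ (edgeNode d)
    ...     | yes ℓₗ-agrees-d = ℓₗ , record { separates = FundamentalCut.separates cutₗ ; agrees = agrees′ }
      where
      agrees′ : ∀ {l′} → l′ ∈ₗ T ⊖ c ⊕ d → l′ ≢ _ → Agrees ℓₗ l′
      agrees′ {l′} l′∈T′ l′≢l with l′ ≟ₗ d
      ... | yes refl = ℓₗ-agrees-d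
      ... | no l′≢d  = FundamentalCut.agrees cutₗ (proj₁ (∈-⊖⁻ (∈-⊕-old l′∈T′ l′≢d))) l′≢l
    -- ℓ agrees on the old link but separates d, so the xor still separates the old link but no longer d.
    ...     | no ℓₗ-separates-d = (λ x → ℓₗ x xor ℓ x) , record { separates = separates′ ; agrees = agrees′ }
      where
      separates′ : Separates (λ x → ℓₗ x xor ℓ x) _
      separates′ = xor-separates (FundamentalCut.separates cutₗ) (agrees-⊖ l∈T⊖c)
      agrees′ : ∀ {l′} → l′ ∈ₗ T ⊖ c ⊕ d → l′ ≢ _ → Agrees (λ x → ℓₗ x xor ℓ x) l′
      agrees′ {l′} l′∈T′ l′≢l with l′ ≟ₗ d
      ... | yes refl = xor-agrees ℓₗ-separates-d d-crosses
      ... | no l′≢d  =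
        cong₂ _xor_ (FundamentalCut.agrees cutₗ (proj₁ (∈-⊖⁻ l′∈T⊖c)) l′≢l) (agrees-⊖ l′∈T⊖c)
        where l′∈T⊖c = ∈-⊕-old l′∈T′ l′≢d

    swap-tree : Tree T → Tree (T ⊖ c ⊕ d)
    swap-tree tree = record
      { connected = swap-connected (Tree.connected tree)
      ; bridges   = swap-bridges (Tree.bridges tree)
      }

  symmetric-exchange : Tree S → Tree T → c ∈ₗ S → c ∉ₗ T →
    ∃[ d ] d ∈ₗ T × d ∉ₗ S × Tree (S ⊖ c ⊕ d) × Tree (T ⊖ d ⊕ c)
  symmetric-exchange {S = S} {T = T} {c = c} treeS treeT c∈S c∉T with Tree.bridges treeS c∈S
  ... | ℓ , cut with walk⇒path (Tree.connected treeT (vertexNode c) (edgeNode c))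
  ... | path xs linked unique ends
    with path-crossing {ℓ = ℓ} (Tree.bridges treeT) linked unique
           (subst (λ y → ℓ (vertexNode c) ≢ ℓ y) (sym ends) (FundamentalCut.separates cut))
  ... | d , d∈T , d-crosses , ℓd , cutd , ℓd-separates =
    d , d∈T , d∉S , swap-tree cut d-crosses treeS ,
    swap-tree cutd (subst (λ y → ℓd (vertexNode c) ≢ ℓd y) ends ℓd-separates) treeT
    where
    d∉S : d ∉ₗ S
    d∉S d∈S = c∉T (subst (_∈ₗ T) (FundamentalCut.separated-unique cut d∈S d-crosses) d∈T)

  -- Exchange for spanning trees and hypertrees

  record SpanningTree (G T : Subgraph n m) : Set where
    field
      subgraph : T ⊆ₗ G
      tree     : Tree T

  ⊆-swap : T ⊆ₗ G → d ∈ₗ G → T ⊖ c ⊕ d ⊆ₗ G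
  ⊆-swap {T = T} T⊆G d∈G l∈ with ∈-⊕⁻ l∈
  ... | inj₁ l∈T⊖c = T⊆G (proj₁ (∈-⊖⁻ {T = T} l∈T⊖c))
  ... | inj₂ refl  = d∈G

  module _ {G T₁ T₂ : Subgraph n m} (st₁ : SpanningTree G T₁) (st₂ : SpanningTree G T₂) where
    open SpanningTree

    swap-down : ∀ {i} → deg T₂ i < deg T₁ i →
      ∃[ j ] ∃[ T₁′ ] SpanningTree G T₁′ × Moves (deg T₁) i j (deg T₁′) ×
                      size (T₁′ ∖ T₂) < size (T₁ ∖ T₂)
    swap-down {i} lt with ∣p∣<∣q∣⇒∃∈q∉p (T₂ i) (T₁ i) lt
    ... | v , v∈T₁ , v∉T₂ with symmetric-exchange (tree st₁) (tree st₂) (link v∈T₁) (v∉T₂ ∘ unlink)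
    ... | (_ , j) , d∈T₂ , d∉T₁ , tree₁′ , _ =
      j , _ , record { subgraph = ⊆-swap (subgraph st₁) (subgraph st₂ d∈T₂) ; tree = tree₁′ } ,
      deg-swap (link v∈T₁) d∉T₁ , size-∖-swapˡ (link v∈T₁) (v∉T₂ ∘ unlink) d∈T₂

    swap-up : ∀ {i} → deg T₂ i < deg T₁ i →
      ∃[ j ] ∃[ T₂′ ] SpanningTree G T₂′ × Moves (deg T₂) j i (deg T₂′) ×
                      size (T₁ ∖ T₂′) < size (T₁ ∖ T₂)
    swap-up {i} lt with ∣p∣<∣q∣⇒∃∈q∉p (T₂ i) (T₁ i) lt
    ... | v , v∈T₁ , v∉T₂ with symmetric-exchange (tree st₁) (tree st₂) (link v∈T₁) (v∉T₂ ∘ unlink)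
    ... | (_ , j) , d∈T₂ , d∉T₁ , _ , tree₂′ =
      j , _ , record { subgraph = ⊆-swap (subgraph st₂) (subgraph st₁ (link v∈T₁)) ; tree = tree₂′ } ,
      deg-swap d∈T₂ (v∉T₂ ∘ unlink) , size-∖-swapʳ (link v∈T₁) (v∉T₂ ∘ unlink) d∉T₁

  spanningTree-exchange-down : ∀ {G T₁ T₂ : Subgraph n m} k → size (T₁ ∖ T₂) < k →
    SpanningTree G T₁ → SpanningTree G T₂ → ∀ {i} → deg T₂ i < deg T₁ i →
    ∃[ j ] deg T₁ j < deg T₂ j × ∃[ T ] SpanningTree G T × Moves (deg T₁) i j (deg T)
  spanningTree-exchange-down (suc k) bound st₁ st₂ lt with swap-down st₁ st₂ lt
  ... | j , T₁′ , st₁′ , moved , shrinks with exchange-step-down moved lt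
  ...   | inj₁ done         = j , done , T₁′ , st₁′ , moved
  ...   | inj₂ (lt′ , back) with spanningTree-exchange-down k (<-≤-trans shrinks (s≤s⁻¹ bound)) st₁′ st₂ lt′
  ...     | j′ , lt″ , T , st , moved′ = j′ , back j′ lt″ , T , st , Moves-trans moved moved′

  spanningTree-exchange-up : ∀ {G T₁ T₂ : Subgraph n m} k → size (T₁ ∖ T₂) < k →
    SpanningTree G T₁ → SpanningTree G T₂ → ∀ {i} → deg T₂ i < deg T₁ i →
    ∃[ j ] deg T₁ j < deg T₂ j × ∃[ T ] SpanningTree G T × Moves (deg T₂) j i (deg T)
  spanningTree-exchange-up (suc k) bound st₁ st₂ lt with swap-up st₁ st₂ lt
  ... | j , T₂′ , st₂′ , moved , shrinks with exchange-step-up moved lt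
  ...   | inj₁ done         = j , done , T₂′ , st₂′ , moved
  ...   | inj₂ (lt′ , back) with spanningTree-exchange-up k (<-≤-trans shrinks (s≤s⁻¹ bound)) st₁ st₂′ lt′
  ...     | j′ , lt″ , T , st , moved′ = j′ , back j′ lt″ , T , st , Moves-trans′ moved moved′

  module _ (f : Fin m → ℕ) (a b : Fin m) where

    transfer-source : transfer f a b a ≡ f a ∸ 1
    transfer-source with a ≟ a
    ... | yes _  = refl
    ... | no a≢a = contradiction refl a≢a

    transfer-target : a ≢ b → transfer f a b b ≡ suc (f b)
    transfer-target a≢b with b ≟ a
    ... | yes b≡a = contradiction (sym b≡a) a≢b
    ... | no _ with b ≟ b
    ...   | yes _  = refl
    ...   | no b≢b = contradiction refl b≢b

    transfer-other : ∀ {e} → e ≢ a → e ≢ b → transfer f a b e ≡ f e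
    transfer-other {e} e≢a e≢b with e ≟ a
    ... | yes e≡a = contradiction e≡a e≢a
    ... | no _ with e ≟ b
    ...   | yes e≡b = contradiction e≡b e≢b
    ...   | no _    = refl

    transfer-moves : a ≢ b → 1 ≤ f a → Moves f a b (transfer f a b)
    transfer-moves a≢b 1≤fa = moves λ e → balance (e ≟ a) (e ≟ b)
      where
      open ≡-Reasoning
      balance : ∀ {e} → Dec (e ≡ a) → Dec (e ≡ b) → transfer f a b e + δ a e ≡ f e + δ b e
      balance (yes refl) _ = begin
        transfer f a b a + δ a a  ≡⟨ cong₂ _+_ transfer-source (δ-refl a) ⟩
        f a ∸ 1 + 1               ≡⟨ m∸n+n≡m 1≤fa ⟩
        f a                       ≡⟨ +-identityʳ (f a) ⟨
        f a + 0                   ≡⟨ cong (f a +_) (δ-≢ (a≢b ∘ sym)) ⟨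
        f a + δ b a               ∎
      balance (no e≢a) (yes refl) = begin
        transfer f a b b + δ a b  ≡⟨ cong₂ _+_ (transfer-target a≢b) (δ-≢ a≢b) ⟩
        suc (f b) + 0             ≡⟨ +-identityʳ (suc (f b)) ⟩
        suc (f b)                 ≡⟨ +-comm 1 (f b) ⟩
        f b + 1                   ≡⟨ cong (f b +_) (δ-refl b) ⟨
        f b + δ b b               ∎
      balance (no e≢a) (no e≢b) =
        cong₂ _+_ (transfer-other e≢a e≢b) (trans (δ-≢ (e≢a ∘ sym)) (sym (δ-≢ (e≢b ∘ sym))))

  module _ (H : Hypergraph n m) where

    isSpanningTree⇒spanningTree : ∀ {T} → IsSpanningTree H T → SpanningTree (edge H) T
    isSpanningTree⇒spanningTree (T⊆H , connected , acyclic) = record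
      { subgraph = λ { (link v∈Te) → link (T⊆H _ v∈Te) }
      ; tree     = record { connected = connected ; bridges = acyclic⇒fundamentalCut connected acyclic }
      }

    spanningTree⇒isSpanningTree : ∀ {T} → SpanningTree (edge H) T → IsSpanningTree H T
    spanningTree⇒isSpanningTree st =
      (λ _ v∈Te → unlink (subgraph (link v∈Te))) , Tree.connected tree , allBridges⇒acyclic (Tree.bridges tree)
      where open SpanningTree st

    moves⇒canTransfer : ∀ {x f : Fin m → ℕ} {T i j} → (∀ e → x e ≡ suc (f e)) →
      SpanningTree (edge H) T → Moves x i j (deg T) → i ≢ j → 1 ≤ f i → CanTransfer H f i j
    moves⇒canTransfer {x = x} {f} {T} {i} {j} realises st (moves moved) i≢j 1≤fi =
      i≢j , 1≤fi , T , spanningTree⇒isSpanningTree st , λ e → +-cancelʳ-≡ (δ i e) _ _ (begin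
        deg T e + δ i e                 ≡⟨ moved e ⟩
        x e + δ j e                     ≡⟨ cong (_+ δ j e) (realises e) ⟩
        suc (f e + δ j e)               ≡⟨ cong suc (Moves.balance (transfer-moves f i j i≢j 1≤fi) e) ⟨
        suc (transfer f i j e + δ i e)  ∎)
      where open ≡-Reasoning

  hypertree-exchange-down : ∀ (H : Hypergraph n m) f g i → IsHypertree H f → IsHypertree H g → g i < f i →
    ∃[ j ] f j < g j × CanTransfer H f i j
  hypertree-exchange-down H f g i (T₁ , spans₁ , realises₁) (T₂ , spans₂ , realises₂) gi<fi =
    conclude (spanningTree-exchange-down _ (n<1+n _) (isSpanningTree⇒spanningTree H spans₁)
                                         (isSpanningTree⇒spanningTree H spans₂)
                                         (subst₂ _<_ (sym (realises₂ i)) (sym (realises₁ i)) (s≤s gi<fi)))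
    where
    conclude : ∃[ j ] deg T₁ j < deg T₂ j × ∃[ T ] SpanningTree (edge H) T × Moves (deg T₁) i j (deg T) →
               ∃[ j ] f j < g j × CanTransfer H f i j
    conclude (j , lt , T , st , moved) =
      j , fj<gj , moves⇒canTransfer H realises₁ st moved i≢j (≤-trans (s≤s z≤n) gi<fi)
      where
      fj<gj : f j < g j
      fj<gj = s<s⁻¹ (subst₂ _<_ (realises₁ j) (realises₂ j) lt)
      i≢j : i ≢ j
      i≢j refl = <-asym gi<fi fj<gj

  hypertree-exchange-up : ∀ (H : Hypergraph n m) f g i → IsHypertree H f → IsHypertree H g → g i < f i →
    ∃[ j ] f j < g j × CanTransfer H g j i
  hypertree-exchange-up H f g i (T₁ , spans₁ , realises₁) (T₂ , spans₂ , realises₂) gi<fi =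
    conclude (spanningTree-exchange-up _ (n<1+n _) (isSpanningTree⇒spanningTree H spans₁)
                                       (isSpanningTree⇒spanningTree H spans₂)
                                       (subst₂ _<_ (sym (realises₂ i)) (sym (realises₁ i)) (s≤s gi<fi)))
    where
    conclude : ∃[ j ] deg T₁ j < deg T₂ j × ∃[ T ] SpanningTree (edge H) T × Moves (deg T₂) j i (deg T) →
               ∃[ j ] f j < g j × CanTransfer H g j i
    conclude (j , lt , T , st , moved) =
      j , fj<gj , moves⇒canTransfer H realises₂ st moved j≢i (≤-trans (s≤s z≤n) fj<gj)
      where
      fj<gj : f j < g j
      fj<gj = s<s⁻¹ (subst₂ _<_ (realises₁ j) (realises₂ j) lt)
      j≢i : j ≢ i
      j≢i refl = <-asym gi<fi fj<gj

open HypertreeExchange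
  using (hypertree-exchange-down; hypertree-exchange-up; transfer-source; transfer-target; transfer-other)

open import Data.Nat using (ℕ)
open import Data.Fin using (Fin; _<_)
open import Data.Product using (_×_)
open import Function.Bundles using (_⇔_)
open import Relation.Binary.PropositionalEquality using (_≡_; _≢_)

import Data.Nat as ℕ
import Data.Nat.Properties as ℕ
open import Data.Fin.Properties using (_≟_; <-irrefl)
open import Data.Product using (_,_)
open import Function using (_∘_)
open import Function.Bundles using (mk⇔)
open import Relation.Binary.PropositionalEquality using (refl; sym; trans; subst; subst₂)
open import Relation.Nullary using (yes; no; contradiction)

module ActivityTransport {n m} (H : Hypergraph n m) (p q : Fin m → ℕ) (e : Fin m) (hp : IsHypertree H p)
                         (differ-below : ∀ j → p j ≢ q j → j < e) where

  private
    pe≡qe : p e ≡ q e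
    pe≡qe with p e ℕ.≟ q e
    ... | yes eq   = eq
    ... | no pe≢qe = contradiction (differ-below e pe≢qe) (<-irrefl refl)

    below : ∀ {e′ j} → e′ < e → (j ≢ e′ → p j ≢ q j) → j < e
    below {e′} {j} e′<e differs with j ≟ e′
    ... | yes refl = e′<e
    ... | no j≢e′  = differ-below j (differs j≢e′)

  internallyActive-transport : InternallyActive H p e → InternallyActive H q e
  internallyActive-transport active e′ e′<e (_ , 1≤qe , hg) =
    let j , pj<gj , p-transfers = hypertree-exchange-down H p g e hp hg ge<pe
    in  active j (below e′<e (differs pj<gj)) p-transfers
    where
    g = transfer q e e′
    ge<pe : g e ℕ.< p e
    ge<pe = subst₂ ℕ._<_ (sym (transfer-source q e e′)) (sym pe≡qe) (ℕ.∸-monoʳ-< (ℕ.s≤s ℕ.z≤n) 1≤qe)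
    differs : ∀ {j} → p j ℕ.< g j → j ≢ e′ → p j ≢ q j
    differs {j} pj<gj j≢e′ pj≡qj = ℕ.<-irrefl (trans pj≡qj (sym (transfer-other q e e′ j≢e j≢e′))) pj<gj
      where
      j≢e : j ≢ e
      j≢e refl = ℕ.<-asym pj<gj ge<pe

  externallyActive-transport : ExternallyActive H p e → ExternallyActive H q e
  externallyActive-transport active e′ e′<e (e′≢e , _ , hg) =
    let j , gj<pj , p-transfers = hypertree-exchange-up H g p e hg hp pe<ge
    in  active j (below e′<e (differs gj<pj)) p-transfers
    where
    g = transfer q e′ e
    pe<ge : p e ℕ.< g e
    pe<ge = subst (p e ℕ.<_) (sym (transfer-target q e′ e e′≢e)) (ℕ.s≤s (ℕ.≤-reflexive pe≡qe))
    differs : ∀ {j} → g j ℕ.< p j → j ≢ e′ → p j ≢ q j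
    differs {j} gj<pj j≢e′ pj≡qj = ℕ.<-irrefl (trans (transfer-other q e′ e j≢e′ j≢e) (sym pj≡qj)) gj<pj
      where
      j≢e : j ≢ e
      j≢e refl = ℕ.<-asym gj<pj pe<ge

activity-invariance : ∀ {n m} (H : Hypergraph n m) (p q : Fin m → ℕ) (e : Fin m) →
  IsHypertree H p → IsHypertree H q → (∀ j → p j ≢ q j → j < e) →
  (InternallyActive H p e ⇔ InternallyActive H q e) × (ExternallyActive H p e ⇔ ExternallyActive H q e)
activity-invariance H p q e hp hq differ-below =
  mk⇔ p→q.internallyActive-transport q→p.internallyActive-transport ,
  mk⇔ p→q.externallyActive-transport q→p.externallyActive-transport
  where
  module p→q = ActivityTransport H p q e hp differ-below
  module q→p = ActivityTransport H q p e hq (λ j → differ-below j ∘ (_∘ sym))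

lemma9 : ∀ {n m} (H : Hypergraph n m) → Connected H →
    (e₁ e₂ : Fin m) → e₁ ≢ e₂ →
    (f₁ f₂ : Fin m → ℕ) → IsHypertree H f₁ → IsHypertree H f₂ →
    Data.Nat._<_ (f₁ e₁) (f₂ e₁) →
    (∀ e → e ≢ e₁ → e ≢ e₂ → f₁ e ≡ f₂ e) →
    ∀ e → e₁ < e → e₂ < e →
    (InternallyActive H f₁ e ⇔ InternallyActive H f₂ e) ×
    (ExternallyActive H f₁ e ⇔ ExternallyActive H f₂ e)
lemma9 H _ e₁ e₂ _ f₁ f₂ h₁ h₂ _ agree e e₁<e e₂<e = activity-invariance H f₁ f₂ e h₁ h₂ differ-below
  where
  differ-below : ∀ j → f₁ j ≢ f₂ j → j < e
  differ-below j differs with j ≟ e₁ | j ≟ e₂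
  ... | yes refl | _        = e₁<e
  ... | no _     | yes refl = e₂<e
  ... | no j≢e₁  | no j≢e₂  = contradiction (agree j j≢e₁ j≢e₂) differs
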